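{- Let $G$ be a domestic game. Then from every $(1,0)$-position of $G$ there is a move to a $(0,1)$-position, and from every non-terminal $(0,1)$-position of $G$ there is a move to a $(1,0)$-position.
   Context: A game is a two-player impartial game given by a directed acyclic graph whose vertices are positions and whose arcs are moves, such that from every position only finitely many positions are reachable. A position with no moves is terminal. For a finite set $S$ of non-negative integers, $\operatorname{mex}(S)$ is the least non-negative integer not in $S$. The (normal) Sprague–Grundy function is $\mathcal{G}(x)=\operatorname{mex}\{\mathcal{G}(y): x\to y\}$ (so $\mathcal{G}(x)=0$ for terminal $x$). The misère Sprague–Grundy function $\mathcal{G}^-$ is defined by $\mathcal{G}^-(x)=1$ for terminal $x$ and $\mathcal{G}^-(x)=\operatorname{mex}\{\mathcal{G}^-(y): x\to y\}$ for non-terminal $x$. A position $x$ is an $(i,j)$-position if $\mathcal{G}(x)=i$ and $\mathcal{G}^-(x)=j$. A game is domestic if it has no $(0,k)$-position and no $(k,0)$-position with $k\ge 2$. -}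

module Defs where

open import Data.Nat using (ℕ; _<_; _≥_)
open import Data.List using (List; []; map)
open import Data.List.Membership.Propositional using (_∈_; _∉_)
open import Data.Product using (_×_; ∃-syntax)
open import Relation.Binary.PropositionalEquality using (_≡_; _≢_)
open import Relation.Nullary using (¬_)
open import Induction.WellFounded using (WellFounded)

IsMex : List ℕ → ℕ → Set
IsMex xs m = (m ∉ xs) × (∀ k → k < m → k ∈ xs)

-- A game: positions, each with a finite list of options (moves), such that the
-- move relation is well-founded (acyclic with finitely many reachable positions,
-- given finite branching, is equivalent to well-foundedness by König's lemma).
record Game : Set₁ where
  field
    Pos   : Set
    moves : Pos → List Pos
    wf    : WellFounded (λ y x → y ∈ moves x)

  Terminal : Pos → Set
  Terminal x = moves x ≡ []

  IsSG : (Pos → ℕ) → Set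
  IsSG g = ∀ x → IsMex (map g (moves x)) (g x)

  IsMisereSG : (Pos → ℕ) → Set
  IsMisereSG g⁻ = (∀ x → Terminal x → g⁻ x ≡ 1)
                × (∀ x → ¬ Terminal x → IsMex (map g⁻ (moves x)) (g⁻ x))

  IsPos : (Pos → ℕ) → (Pos → ℕ) → ℕ → ℕ → Pos → Set
  IsPos g g⁻ i j x = (g x ≡ i) × (g⁻ x ≡ j)

  Domestic : (Pos → ℕ) → (Pos → ℕ) → Set
  Domestic g g⁻ = ∀ x k → k ≥ 2 → ¬ IsPos g g⁻ 0 k x × ¬ IsPos g g⁻ k 0 x

module Submission where

-- A position of value 1 (under either Sprague–Grundy function) has an option y of value 0.
-- The other function cannot vanish at y, since x has value 0 there and a mex differs from
-- every option's value; domesticity forbids (0,k)- and (k,0)-positions with k ≥ 2, so the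
-- other value at y is 1. The misère mex only applies to non-terminal x, which is automatic
-- in the first case because x has an option.

open import Defs
open import Data.Nat using (ℕ; zero; suc; _<_; _≥_; s≤s; z≤n)
open import Data.List using (List; []; map)
open import Data.List.Membership.Propositional using (_∈_)
open import Data.List.Membership.Propositional.Properties using (∈-map⁻; ∈-map⁺)
open import Data.Product using (_×_; ∃-syntax; _,_; proj₁; proj₂)
open import Relation.Nullary using (¬_)
open import Relation.Binary.PropositionalEquality using (_≡_; _≢_; refl; sym; subst)
open import Data.Empty using (⊥-elim)

module _ {A : Set} (f : A → ℕ) {xs : List A} {m : ℕ} (mex : IsMex (map f xs) m) where

  IsMex-option-value : ∀ {k} → k < m → ∃[ y ] (y ∈ xs × f y ≡ k)
  IsMex-option-value k<m with ∈-map⁻ f (proj₂ mex _ k<m)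
  ... | y , y∈xs , k≡fy = y , y∈xs , sym k≡fy

  IsMex-option-≢ : ∀ {y} → y ∈ xs → f y ≢ m
  IsMex-option-≢ y∈xs fy≡m =
    proj₁ mex (subst (_∈ map f xs) fy≡m (∈-map⁺ f y∈xs))

∈⇒non-empty : {A : Set} {y : A} {xs : List A} → y ∈ xs → xs ≢ []
∈⇒non-empty () refl

n≢0∧n≱2⇒n≡1 : ∀ {n} → n ≢ 0 → ¬ n ≥ 2 → n ≡ 1
n≢0∧n≱2⇒n≡1 {zero}        n≢0 _   = ⊥-elim (n≢0 refl)
n≢0∧n≱2⇒n≡1 {suc zero}    _   _   = refl
n≢0∧n≱2⇒n≡1 {suc (suc n)} _   n≱2 = ⊥-elim (n≱2 (s≤s (s≤s z≤n)))

module _ (G : Game) (g g⁻ : Game.Pos G → ℕ)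
         (sg : Game.IsSG G g) (msg : Game.IsMisereSG G g⁻) (dom : Game.Domestic G g g⁻) where
  open Game G

  move-from-1-0-to-0-1 : ∀ x → IsPos g g⁻ 1 0 x → ∃[ y ] (y ∈ moves x × IsPos g g⁻ 0 1 y)
  move-from-1-0-to-0-1 x (gx≡1 , g⁻x≡0)
    with IsMex-option-value g (sg x) (subst (0 <_) (sym gx≡1) (s≤s z≤n))
  ... | y , y∈moves , gy≡0 = y , y∈moves , gy≡0 , n≢0∧n≱2⇒n≡1 g⁻y≢0 g⁻y≱2
    where
    mex⁻ : IsMex (map g⁻ (moves x)) (g⁻ x)
    mex⁻ = proj₂ msg x (∈⇒non-empty y∈moves)
    g⁻y≢0 : g⁻ y ≢ 0
    g⁻y≢0 g⁻y≡0 = IsMex-option-≢ g⁻ mex⁻ y∈moves (subst (g⁻ y ≡_) (sym g⁻x≡0) g⁻y≡0)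
    g⁻y≱2 : ¬ g⁻ y ≥ 2
    g⁻y≱2 g⁻y≥2 = proj₁ (dom y (g⁻ y) g⁻y≥2) (gy≡0 , refl)

  move-from-0-1-to-1-0 :
    ∀ x → ¬ Terminal x → IsPos g g⁻ 0 1 x → ∃[ y ] (y ∈ moves x × IsPos g g⁻ 1 0 y)
  move-from-0-1-to-1-0 x x-nonterminal (gx≡0 , g⁻x≡1)
    with IsMex-option-value g⁻ (proj₂ msg x x-nonterminal) (subst (0 <_) (sym g⁻x≡1) (s≤s z≤n))
  ... | y , y∈moves , g⁻y≡0 = y , y∈moves , n≢0∧n≱2⇒n≡1 gy≢0 gy≱2 , g⁻y≡0
    where
    gy≢0 : g y ≢ 0
    gy≢0 gy≡0 = IsMex-option-≢ g (sg x) y∈moves (subst (g y ≡_) (sym gx≡0) gy≡0)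
    gy≱2 : ¬ g y ≥ 2
    gy≱2 gy≥2 = proj₂ (dom y (g y) gy≥2) (refl , g⁻y≡0)

lemma3p1 : (G : Game) → let open Game G in
    (g g⁻ : Pos → ℕ) → IsSG g → IsMisereSG g⁻ → Domestic g g⁻ →
    (∀ x → IsPos g g⁻ 1 0 x → ∃[ y ] (y ∈ moves x × IsPos g g⁻ 0 1 y))
    × (∀ x → ¬ Terminal x → IsPos g g⁻ 0 1 x → ∃[ y ] (y ∈ moves x × IsPos g g⁻ 1 0 y))
lemma3p1 G g g⁻ sg msg dom =
  move-from-1-0-to-0-1 G g g⁻ sg msg dom , move-from-0-1-to-1-0 G g g⁻ sg msg dom
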